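{- Let $m\ge 5$ and let $n\ge 5$ be odd. Then the radio number of the stacked-book graph $G_{m,n}=S_m\Box P_n$ satisfies $$rn(G_{m,n})\le \tfrac{1}{2}\left(mn^2+2n+m-2\right).$$
   Context: $S_m$ is the star on $m$ vertices (one center adjacent to $m-1$ leaves) and $P_n$ is the path on $n$ vertices. The stacked-book graph $G_{m,n}=S_m\Box P_n$ is their Cartesian product, with vertex set $V(S_m)\times V(P_n)$; two vertices $(a,i),(b,j)$ are adjacent iff either $a=b$ and $ij\in E(P_n)$, or $i=j$ and $ab\in E(S_m)$. For a connected graph $G$ with diameter $\mathrm{diam}(G)$ and distance $d$, a radio labeling is a function $f:V(G)\to\mathbb{Z}_{\ge 0}$ with $|f(u)-f(v)|\ge \mathrm{diam}(G)+1-d(u,v)$ for all distinct $u,v\in V(G)$; its span is $\max f-\min f$, and the radio number $rn(G)$ is the minimum span over all radio labelings of $G$. -}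

module Defs where

open import Data.Nat using (ℕ; zero; suc; _+_; _*_; _∸_; _≤_; _⊔_; _⊓_; ∣_-_∣)
open import Data.Fin using (Fin; toℕ)
open import Data.Product using (_×_; _,_; ∃; Σ-syntax)
open import Data.Sum using (_⊎_)
open import Data.List using (List; map; foldr; allFin; cartesianProduct)
open import Relation.Binary.PropositionalEquality using (_≡_; _≢_)

-- Star S_m on vertex set Fin m: vertex 0 is the centre (m ≥ 1 whenever used).
StarAdj : (m : ℕ) → Fin m → Fin m → Set
StarAdj m a b = (toℕ a ≡ 0 × toℕ b ≢ 0) ⊎ (toℕ b ≡ 0 × toℕ a ≢ 0)

PathAdj : (n : ℕ) → Fin n → Fin n → Set
PathAdj n i j = (suc (toℕ i) ≡ toℕ j) ⊎ (suc (toℕ j) ≡ toℕ i)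

V : ℕ → ℕ → Set
V m n = Fin m × Fin n

Adj : (m n : ℕ) → V m n → V m n → Set
Adj m n (a , i) (b , j) = (a ≡ b × PathAdj n i j) ⊎ (i ≡ j × StarAdj m a b)

data Walk (m n : ℕ) : V m n → V m n → ℕ → Set where
  nil  : ∀ {u} → Walk m n u u 0
  cons : ∀ {u w v k} → Adj m n u w → Walk m n w v k → Walk m n u v (suc k)

Dist : (m n : ℕ) → V m n → V m n → ℕ → Set
Dist m n u v k = Walk m n u v k × (∀ j → Walk m n u v j → k ≤ j)

IsDiameter : (m n : ℕ) → ℕ → Set
IsDiameter m n D =
  (∀ u v → ∃ λ k → Dist m n u v k × k ≤ D) × (∃ λ u → ∃ λ v → Dist m n u v D)

IsRadioLabeling : (m n : ℕ) → ℕ → (V m n → ℕ) → Set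
IsRadioLabeling m n D f =
  ∀ u v → u ≢ v → ∀ k → Dist m n u v k → D + 1 ∸ k ≤ ∣ f u - f v ∣

vertices : (m n : ℕ) → List (V m n)
vertices m n = cartesianProduct (allFin m) (allFin n)

maxLabel : (m n : ℕ) → (V m n → ℕ) → ℕ
maxLabel m n f = foldr _⊔_ 0 (map f (vertices m n))

minLabel : (m n : ℕ) → (V m n → ℕ) → ℕ
minLabel m n f = foldr _⊓_ (maxLabel m n f) (map f (vertices m n))

span : (m n : ℕ) → (V m n → ℕ) → ℕ
span m n f = maxLabel m n f ∸ minLabel m n f

{-# OPTIONS --safe #-}
-- Order the vertices as x₀, x₁, …, x_T and label them greedily:
-- f(x₀) = 0 and f(x_{t+1}) = f(x_t) + diam + 1 − d(x_t, x_{t+1}).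
-- This is a radio labelling as soon as, all along the order,
-- d(x_t, x_{t+1}) + d(x_{t+1}, x_{t+2}) ≤ diam + 1 + d(x_t, x_{t+2}) and any three
-- consecutive steps have total length at most 2 (diam + 1): labels further apart
-- then differ by at least diam + 1.  For n = 2K + 5 the order starts in the middle
-- of the spine, visits the top, bottom and middle rows of the pages in rounds, then
-- the remaining page vertices in pairs K + 2 rows apart, and ends on the spine.
-- Consecutive page vertices lie on different pages (cyclic shifts of the page index,
-- which needs m − 1 ≥ 4 pages), so the steps are nearly as long as the diameter and
-- the last label is exactly (m n² + 2n + m − 2) / 2.
module Submission where

open import Defs
open import Data.Empty using (⊥-elim)
open import Data.Fin using (Fin; toℕ; fromℕ; fromℕ<) renaming (zero to fzero; suc to fsuc)
open import Data.Fin.Properties using (toℕ<n; toℕ-injective; toℕ-fromℕ<; toℕ-fromℕ)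
open import Data.List using ([]; _∷_)
open import Data.List.Properties using (foldr-preservesᵇ)
open import Data.List.Relation.Unary.All using (universal)
open import Data.List.Relation.Unary.All.Properties using (map⁺)
open import Data.Nat
  using (ℕ; zero; suc; _+_; _*_; _∸_; _≤_; _<_; _%_; _/_; z≤n; s≤s; s≤s⁻¹; z<s; s<s; ∣_-_∣; _≟_)
open import Data.Nat.DivMod using (m≡m%n+[m/n]*n)
open import Data.Nat.Properties
open import Data.Nat.Tactic.RingSolver using (solve)
open import Data.Product using (_×_; _,_; Σ; ∃; proj₁; proj₂)
open import Data.Sum using (_⊎_; inj₁; inj₂)
open import Data.Unit using (⊤; tt)
open import Relation.Binary.Definitions using (tri<; tri≈; tri>)
open import Relation.Binary.PropositionalEquality
open import Relation.Nullary using (yes; no; contradiction)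

coords : ∀ {m n} → V m n → ℕ × ℕ
coords (a , i) = toℕ a , toℕ i

starDist : ℕ → ℕ → ℕ
starDist zero    zero    = 0
starDist zero    (suc _) = 1
starDist (suc _) zero    = 1
starDist (suc a) (suc b) with a ≟ b
... | yes _ = 0
... | no _  = 2

bookDist : ℕ × ℕ → ℕ × ℕ → ℕ
bookDist (a , p) (b , q) = starDist a b + ∣ p - q ∣

starDist-refl : ∀ a → starDist a a ≡ 0
starDist-refl zero = refl
starDist-refl (suc a) with a ≟ a
... | yes _  = refl
... | no a≢a = ⊥-elim (a≢a refl)

starDist-sym : ∀ a b → starDist a b ≡ starDist b a
starDist-sym zero    zero    = refl
starDist-sym zero    (suc b) = refl
starDist-sym (suc a) zero    = refl
starDist-sym (suc a) (suc b) with a ≟ b | b ≟ a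
... | yes _   | yes _   = refl
... | no _    | no _    = refl
... | yes a≡b | no b≢a  = ⊥-elim (b≢a (sym a≡b))
... | no a≢b  | yes b≡a = ⊥-elim (a≢b (sym b≡a))

starDist≤2 : ∀ a b → starDist a b ≤ 2
starDist≤2 zero    zero    = z≤n
starDist≤2 zero    (suc b) = s≤s z≤n
starDist≤2 (suc a) zero    = s≤s z≤n
starDist≤2 (suc a) (suc b) with a ≟ b
... | yes _ = z≤n
... | no _  = ≤-refl

starDist-leaves : ∀ {a b} → a ≢ b → starDist (suc a) (suc b) ≡ 2
starDist-leaves {a} {b} a≢b with a ≟ b
... | yes a≡b = ⊥-elim (a≢b a≡b)
... | no _    = refl

starDist-adjacent : ∀ a a' b → (a ≡ 0 × a' ≢ 0) ⊎ (a' ≡ 0 × a ≢ 0) →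
                    starDist a b ≤ suc (starDist a' b)
starDist-adjacent .0      a'  zero    (inj₁ (refl , _)) = z≤n
starDist-adjacent .0      a'  (suc b) (inj₁ (refl , _)) = s≤s z≤n
starDist-adjacent zero    .0  b       (inj₂ (refl , 0≢0)) = ⊥-elim (0≢0 refl)
starDist-adjacent (suc a) .0  zero    (inj₂ (refl , _)) = ≤-refl
starDist-adjacent (suc a) .0  (suc b) (inj₂ (refl , _)) = starDist≤2 (suc a) (suc b)

bookDist-sym : ∀ u v → bookDist u v ≡ bookDist v u
bookDist-sym (a , p) (b , q) = cong₂ _+_ (starDist-sym a b) (∣-∣-comm p q)

∣n-1+n∣≡1 : ∀ n → ∣ n - suc n ∣ ≡ 1
∣n-1+n∣≡1 zero    = refl
∣n-1+n∣≡1 (suc n) = ∣n-1+n∣≡1 n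

pathAdj-dist : ∀ p q → (suc p ≡ q) ⊎ (suc q ≡ p) → ∣ p - q ∣ ≡ 1
pathAdj-dist p .(suc p) (inj₁ refl) = ∣n-1+n∣≡1 p
pathAdj-dist .(suc q) q (inj₂ refl) = trans (∣-∣-comm (suc q) q) (∣n-1+n∣≡1 q)

bookDist-adjacent : ∀ {m n} {u w : V m n} (v : V m n) → Adj m n u w →
                    bookDist (coords u) (coords v) ≤ suc (bookDist (coords w) (coords v))
bookDist-adjacent {u = a , i} {w = .a , i'} (b , j) (inj₁ (refl , i~i')) = begin
  starDist (toℕ a) (toℕ b) + ∣ toℕ i - toℕ j ∣
    ≤⟨ +-monoʳ-≤ _ (∣-∣-triangle (toℕ i) (toℕ i') (toℕ j)) ⟩
  starDist (toℕ a) (toℕ b) + (∣ toℕ i - toℕ i' ∣ + ∣ toℕ i' - toℕ j ∣)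
    ≡⟨ cong (λ e → starDist (toℕ a) (toℕ b) + (e + ∣ toℕ i' - toℕ j ∣)) (pathAdj-dist _ _ i~i') ⟩
  starDist (toℕ a) (toℕ b) + suc ∣ toℕ i' - toℕ j ∣
    ≡⟨ +-suc _ _ ⟩
  suc (starDist (toℕ a) (toℕ b) + ∣ toℕ i' - toℕ j ∣) ∎
  where open ≤-Reasoning
bookDist-adjacent {u = a , i} {w = a' , .i} (b , j) (inj₂ (refl , a~a')) =
  +-monoˡ-≤ ∣ toℕ i - toℕ j ∣ (starDist-adjacent (toℕ a) (toℕ a') (toℕ b) a~a')

bookDist≤length : ∀ {m n} {u v : V m n} {k} → Walk m n u v k →
                  bookDist (coords u) (coords v) ≤ k
bookDist≤length {u = a , i} nil =
  ≤-reflexive (cong₂ _+_ (starDist-refl (toℕ a)) (∣n-n∣≡0 (toℕ i)))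
bookDist≤length {v = v} (cons u~w w⇝v) =
  ≤-trans (bookDist-adjacent v u~w) (s≤s (bookDist≤length w⇝v))

_++ʷ_ : ∀ {m n} {u w v : V m n} {k l} → Walk m n u w k → Walk m n w v l → Walk m n u v (k + l)
nil          ++ʷ w⇝v = w⇝v
cons u~w u⇝w ++ʷ w⇝v = cons u~w (u⇝w ++ʷ w⇝v)

climb : ∀ {m n} (a : Fin m) (i j : Fin n) d → toℕ i + d ≡ toℕ j → Walk m n (a , i) (a , j) d
climb a i j zero i≡j rewrite toℕ-injective (trans (sym (+-identityʳ (toℕ i))) i≡j) = nil
climb {n = n} a i j (suc d) i+1+d≡j =
  cons (inj₁ (refl , inj₁ (sym (toℕ-fromℕ< i+1<n)))) (climb a (fromℕ< i+1<n) j d i′+d≡j)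
  where
  i+1+d≡j′ : suc (toℕ i + d) ≡ toℕ j
  i+1+d≡j′ = trans (sym (+-suc (toℕ i) d)) i+1+d≡j
  i+1<n : suc (toℕ i) < n
  i+1<n = ≤-trans (s≤s (≤-trans (m≤m+n (suc (toℕ i)) d) (≤-reflexive i+1+d≡j′))) (toℕ<n j)
  i′+d≡j : toℕ (fromℕ< i+1<n) + d ≡ toℕ j
  i′+d≡j = trans (cong (_+ d) (toℕ-fromℕ< i+1<n)) i+1+d≡j′

descend : ∀ {m n} (a : Fin m) (i j : Fin n) d → toℕ j + d ≡ toℕ i → Walk m n (a , i) (a , j) d
descend a i j zero j≡i rewrite toℕ-injective (trans (sym j≡i) (+-identityʳ (toℕ j))) = nil
descend {n = n} a i j (suc d) j+1+d≡i =
  cons (inj₁ (refl , inj₂ (trans (cong suc (toℕ-fromℕ< j+d<n)) j+1+d≡i′)))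
       (descend a (fromℕ< j+d<n) j d (sym (toℕ-fromℕ< j+d<n)))
  where
  j+1+d≡i′ : suc (toℕ j + d) ≡ toℕ i
  j+1+d≡i′ = trans (sym (+-suc (toℕ j) d)) j+1+d≡i
  j+d<n : toℕ j + d < n
  j+d<n = ≤-trans (≤-reflexive j+1+d≡i′) (<⇒≤ (toℕ<n i))

verticalWalk : ∀ {m n} (a : Fin m) (i j : Fin n) → Walk m n (a , i) (a , j) ∣ toℕ i - toℕ j ∣
verticalWalk a i j with ≤-total (toℕ i) (toℕ j)
... | inj₁ i≤j = subst (Walk _ _ _ _) (sym (m≤n⇒∣m-n∣≡n∸m i≤j)) (climb a i j _ (m+[n∸m]≡n i≤j))
... | inj₂ j≤i = subst (Walk _ _ _ _) (sym (m≤n⇒∣n-m∣≡n∸m j≤i)) (descend a i j _ (m+[n∸m]≡n j≤i))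

horizontalWalk : ∀ {M n} (a b : Fin (suc M)) (j : Fin n) →
                 Walk (suc M) n (a , j) (b , j) (starDist (toℕ a) (toℕ b))
horizontalWalk fzero    fzero    j = nil
horizontalWalk fzero    (fsuc b) j = cons (inj₂ (refl , inj₁ (refl , λ ()))) nil
horizontalWalk (fsuc a) fzero    j = cons (inj₂ (refl , inj₂ (refl , λ ()))) nil
horizontalWalk (fsuc a) (fsuc b) j with toℕ a ≟ toℕ b
... | yes a≡b rewrite toℕ-injective a≡b = nil
... | no _ = cons (inj₂ (refl , inj₂ (refl , λ ()))) (cons (inj₂ (refl , inj₁ (refl , λ ()))) nil)

bookDist-isDist : ∀ {M n} (u v : V (suc M) n) → Dist (suc M) n u v (bookDist (coords u) (coords v))
bookDist-isDist (a , i) (b , j) =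
  horizontalWalk a b i ++ʷ verticalWalk b i j , λ _ → bookDist≤length

bookDist≤ : ∀ {m n} (u v : V m (suc n)) → bookDist (coords u) (coords v) ≤ 2 + n
bookDist≤ (a , i) (b , j) = +-mono-≤ (starDist≤2 (toℕ a) (toℕ b))
  (≤-trans (∣m-n∣≤m⊔n (toℕ i) (toℕ j)) (⊔-lub (s≤s⁻¹ (toℕ<n i)) (s≤s⁻¹ (toℕ<n j))))

isDiameter : ∀ M n → IsDiameter (3 + M) (suc n) (2 + n)
isDiameter M n =
  (λ u v → _ , bookDist-isDist u v , bookDist≤ u v) ,
  u , v , subst (Dist _ _ u v) (cong (2 +_) (toℕ-fromℕ n)) (bookDist-isDist u v)
  where
  u v : V (3 + M) (suc n)
  u = fsuc fzero , fzero
  v = fsuc (fsuc fzero) , fromℕ n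

coords-injective : ∀ {m n} {u v : V m n} → coords u ≡ coords v → u ≡ v
coords-injective {u = a , i} {b , j} eq =
  cong₂ _,_ (toℕ-injective (cong proj₁ eq)) (toℕ-injective (cong proj₂ eq))

isRadioLabeling : ∀ {m n} D (f : V m n → ℕ) →
  (∀ u v → u ≢ v → D + 1 ≤ ∣ f u - f v ∣ + bookDist (coords u) (coords v)) →
  IsRadioLabeling m n D f
isRadioLabeling D f gap u v u≢v k (u⇝v , _) = ≤-trans (∸-monoʳ-≤ (D + 1) (bookDist≤length u⇝v))
  (m≤n+o⇒m∸n≤o (D + 1) _
    (subst (D + 1 ≤_) (+-comm _ (bookDist (coords u) (coords v))) (gap u v u≢v)))

span≤ : ∀ {m n} (f : V m n → ℕ) B → (∀ u → f u ≤ B) → span m n f ≤ B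
span≤ {m} {n} f B f≤B = ≤-trans (m∸n≤m (maxLabel m n f) (minLabel m n f))
  (foldr-preservesᵇ {P = _≤ B} ⊔-lub z≤n (map⁺ (universal f≤B (vertices m n))))

a+w≤b+e⇒w≤∣a-b∣+e : ∀ a b {w e} → a + w ≤ b + e → w ≤ ∣ a - b ∣ + e
a+w≤b+e⇒w≤∣a-b∣+e a b {w} {e} a+w≤b+e with ≤-total a b
... | inj₁ a≤b = +-cancelˡ-≤ a w _ (begin
  a + w                 ≤⟨ a+w≤b+e ⟩
  b + e                 ≡⟨ cong (_+ e) (sym (m+[n∸m]≡n a≤b)) ⟩
  a + (b ∸ a) + e       ≡⟨ +-assoc a _ e ⟩
  a + ((b ∸ a) + e)     ≡⟨ cong (λ d → a + (d + e)) (sym (m≤n⇒∣m-n∣≡n∸m a≤b)) ⟩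
  a + (∣ a - b ∣ + e)   ∎)
  where open ≤-Reasoning
... | inj₂ b≤a = ≤-trans (+-cancelˡ-≤ a w e (≤-trans a+w≤b+e (+-monoˡ-≤ e b≤a))) (m≤n+m e _)

two-step-gap : ∀ a b c w e f g → a + w ≡ b + e → b + w ≡ c + f → e + f ≤ w + g → a + w ≤ c + g
two-step-gap a b c w e f g p q r = +-cancelʳ-≤ w _ _ (begin
  a + w + w     ≡⟨ cong (_+ w) p ⟩
  b + e + w     ≡⟨ solve (b ∷ e ∷ w ∷ []) ⟩
  b + w + e     ≡⟨ cong (_+ e) q ⟩
  c + f + e     ≡⟨ solve (c ∷ f ∷ e ∷ []) ⟩
  c + (e + f)   ≤⟨ +-monoʳ-≤ c r ⟩
  c + (w + g)   ≡⟨ solve (c ∷ w ∷ g ∷ []) ⟩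
  c + g + w     ∎)
  where open ≤-Reasoning

three-step-gap : ∀ a b c d w e f g → a + w ≡ b + e → b + w ≡ c + f → c + w ≡ d + g →
                 e + f + g ≤ 2 * w → a + w ≤ d
three-step-gap a b c d w e f g p q r s = +-cancelʳ-≤ (2 * w) _ _ (begin
  a + w + 2 * w       ≡⟨ solve (a ∷ w ∷ []) ⟩
  (a + w) + w + w     ≡⟨ cong (λ z → z + w + w) p ⟩
  (b + e) + w + w     ≡⟨ solve (b ∷ e ∷ w ∷ []) ⟩
  (b + w) + w + e     ≡⟨ cong (λ z → z + w + e) q ⟩
  (c + f) + w + e     ≡⟨ solve (c ∷ f ∷ w ∷ e ∷ []) ⟩
  (c + w) + (e + f)   ≡⟨ cong (_+ (e + f)) r ⟩
  (d + g) + (e + f)   ≡⟨ solve (d ∷ g ∷ e ∷ f ∷ []) ⟩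
  d + (e + f + g)     ≤⟨ +-monoʳ-≤ d s ⟩
  d + 2 * w           ∎)
  where open ≤-Reasoning

module DistanceGapOrdering {A : Set} (d : A → A → ℕ) (W T : ℕ) (x : ℕ → A) (F : ℕ → ℕ)
  (step : ∀ t → suc t ≤ T → F t + W ≡ F (suc t) + d (x t) (x (suc t)))
  (step≤ : ∀ t → suc t ≤ T → d (x t) (x (suc t)) ≤ W)
  (two-steps : ∀ t → 2 + t ≤ T →
    d (x t) (x (1 + t)) + d (x (1 + t)) (x (2 + t)) ≤ W + d (x t) (x (2 + t)))
  (three-steps : ∀ t → 3 + t ≤ T →
    d (x t) (x (1 + t)) + d (x (1 + t)) (x (2 + t)) + d (x (2 + t)) (x (3 + t)) ≤ 2 * W)
  where

  F-step : ∀ t → suc t ≤ T → F t ≤ F (suc t)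
  F-step t le = +-cancelʳ-≤ W _ _ (begin
    F t + W                         ≡⟨ step t le ⟩
    F (suc t) + d (x t) (x (suc t)) ≤⟨ +-monoʳ-≤ _ (step≤ t le) ⟩
    F (suc t) + W                   ∎)
    where open ≤-Reasoning

  F-mono : ∀ {s t} → s ≤ t → t ≤ T → F s ≤ F t
  F-mono {t = zero}  z≤n    _ = ≤-refl
  F-mono {t = suc t} s≤1+t le with m≤n⇒m<n∨m≡n s≤1+t
  ... | inj₁ s<1+t = ≤-trans (F-mono (s≤s⁻¹ s<1+t) (<⇒≤ le)) (F-step t le)
  ... | inj₂ refl  = ≤-refl

  gap-after : ∀ s δ → δ + suc s ≤ T → F s + W ≤ F (δ + suc s) + d (x s) (x (δ + suc s))
  gap-after s zero le = ≤-reflexive (step s le)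
  gap-after s (suc zero) le =
    two-step-gap _ _ _ W _ _ _ (step s (<⇒≤ le)) (step (1 + s) le) (two-steps s le)
  gap-after s (suc (suc δ)) le = ≤-trans
    (three-step-gap _ _ _ _ W _ _ _ (step s (≤-trans (s≤s (m≤n+m s 2)) le₃))
       (step (1 + s) (≤-trans (s≤s (s≤s (m≤n+m s 1))) le₃)) (step (2 + s) le₃) (three-steps s le₃))
    (≤-trans (F-mono 3+s≤ le) (m≤m+n _ _))
    where
    3+s≤ : 3 + s ≤ 2 + δ + suc s
    3+s≤ = s≤s (s≤s (m≤n+m (suc s) δ))
    le₃ : 3 + s ≤ T
    le₃ = ≤-trans 3+s≤ le

  radio-condition< : ∀ {s t} → s < t → t ≤ T → F s + W ≤ F t + d (x s) (x t)
  radio-condition< {s} {t} s<t t≤T = subst (λ z → F s + W ≤ F z + d (x s) (x z)) (m∸n+n≡m s<t)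
    (gap-after s (t ∸ suc s) (subst (_≤ T) (sym (m∸n+n≡m s<t)) t≤T))

  radio-condition : (∀ u v → d u v ≡ d v u) → ∀ {s t} → s ≢ t → s ≤ T → t ≤ T →
                    W ≤ ∣ F s - F t ∣ + d (x s) (x t)
  radio-condition d-sym {s} {t} s≢t s≤T t≤T with <-cmp s t
  ... | tri< s<t _ _ = a+w≤b+e⇒w≤∣a-b∣+e (F s) (F t) (radio-condition< s<t t≤T)
  ... | tri≈ _ s≡t _ = ⊥-elim (s≢t s≡t)
  ... | tri> _ _ t<s = subst₂ (λ a b → W ≤ a + b) (∣-∣-comm (F t) (F s)) (d-sym (x t) (x s))
                         (a+w≤b+e⇒w≤∣a-b∣+e (F t) (F s) (radio-condition< t<s s≤T))

module CyclicShift (M : ℕ) where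

  shift : ℕ → ℕ
  shift s with M ≟ s
  ... | yes _ = 0
  ... | no _  = suc s

  shift^ : ℕ → ℕ → ℕ
  shift^ zero    s = s
  shift^ (suc k) s = shift (shift^ k s)

  shift-cases : ∀ {s} → s ≤ M → (s < M × shift s ≡ suc s) ⊎ (s ≡ M × shift s ≡ 0)
  shift-cases {s} s≤M with M ≟ s
  ... | yes M≡s = inj₂ (sym M≡s , refl)
  ... | no M≢s  = inj₁ (≤∧≢⇒< s≤M (λ s≡M → M≢s (sym s≡M)) , refl)

  shift-< : ∀ {s} → s < M → shift s ≡ suc s
  shift-< {s} s<M with M ≟ s
  ... | yes M≡s = ⊥-elim (<-irrefl (sym M≡s) s<M)
  ... | no _    = refl

  shift-max : shift M ≡ 0
  shift-max with M ≟ M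
  ... | yes _   = refl
  ... | no M≢M = ⊥-elim (M≢M refl)

  shift-≤ : ∀ {s} → s ≤ M → shift s ≤ M
  shift-≤ s≤M with shift-cases s≤M
  ... | inj₁ (s<M , eq) = subst (_≤ M) (sym eq) s<M
  ... | inj₂ (_ , eq)   = subst (_≤ M) (sym eq) z≤n

  shift^-≤ : ∀ k {s} → s ≤ M → shift^ k s ≤ M
  shift^-≤ zero    s≤M = s≤M
  shift^-≤ (suc k) s≤M = shift-≤ (shift^-≤ k s≤M)

  shift^-+ : ∀ a b s → shift^ (a + b) s ≡ shift^ a (shift^ b s)
  shift^-+ zero    b s = refl
  shift^-+ (suc a) b s = cong shift (shift^-+ a b s)

  shift^-winding : ∀ k {s} → s ≤ M → ∃ λ c → shift^ k s + c * suc M ≡ k + s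
  shift^-winding zero    {s} _   = 0 , +-identityʳ s
  shift^-winding (suc k) {s} s≤M with shift^-winding k s≤M | shift-cases (shift^-≤ k s≤M)
  ... | c , eq | inj₁ (_ , shift≡suc) = c , trans (cong (_+ c * suc M) shift≡suc) (cong suc eq)
  ... | c , eq | inj₂ (≡M , shift≡0)  = suc c , trans (cong (_+ suc c * suc M) shift≡0)
                                                  (cong suc (trans (cong (_+ c * suc M) (sym ≡M)) eq))

  shift^-≢ : ∀ k {s} → 0 < k → k ≤ M → s ≤ M → shift^ k s ≢ s
  shift^-≢ k {s} 0<k k≤M s≤M shift^k≡s with shift^-winding k s≤M
  ... | c , eq = winding≢k c (+-cancelˡ-≡ s _ _
                   (trans (cong (_+ c * suc M) (sym shift^k≡s)) (trans eq (+-comm k s))))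
    where
    winding≢k : ∀ c → c * suc M ≢ k
    winding≢k zero    0≡k  = <-irrefl 0≡k 0<k
    winding≢k (suc c) cM≡k =
      <-irrefl refl (≤-trans (s≤s k≤M) (≤-trans (m≤m+n (suc M) _) (≤-reflexive cM≡k)))

  shift^-distinct : ∀ j k {s} → j < k → k ≤ M → s ≤ M → shift^ j s ≢ shift^ k s
  shift^-distinct j k {s} j<k k≤M s≤M eq = shift^-≢ (k ∸ j) (m<n⇒0<n∸m j<k)
    (≤-trans (m∸n≤m k j) k≤M) (shift^-≤ j s≤M)
    (trans (sym (shift^-+ (k ∸ j) j s))
           (trans (cong (λ e → shift^ e s) (m∸n+n≡m (<⇒≤ j<k))) (sym eq)))

  unshift : ℕ → ℕ
  unshift zero    = M
  unshift (suc s) = s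

  unshift^ : ℕ → ℕ → ℕ
  unshift^ zero    s = s
  unshift^ (suc k) s = unshift^ k (unshift s)

  unshift-≤ : ∀ {s} → s ≤ M → unshift s ≤ M
  unshift-≤ {zero}  _   = ≤-refl
  unshift-≤ {suc s} s<M = <⇒≤ s<M

  unshift^-≤ : ∀ k {s} → s ≤ M → unshift^ k s ≤ M
  unshift^-≤ zero    s≤M = s≤M
  unshift^-≤ (suc k) s≤M = unshift^-≤ k (unshift-≤ s≤M)

  shift-unshift : ∀ {s} → s ≤ M → shift (unshift s) ≡ s
  shift-unshift {zero}  _   = shift-max
  shift-unshift {suc s} s<M = shift-< s<M

  shift^-unshift^ : ∀ k {s} → s ≤ M → shift^ k (unshift^ k s) ≡ s
  shift^-unshift^ zero    _   = refl
  shift^-unshift^ (suc k) s≤M =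
    trans (cong shift (shift^-unshift^ k (unshift-≤ s≤M))) (shift-unshift s≤M)

m+k≡n⇒m≤n : ∀ m n k → m + k ≡ n → m ≤ n
m+k≡n⇒m≤n m .(m + k) k refl = m≤m+n m k

∣-∣-by : ∀ p q e → p + e ≡ q → ∣ p - q ∣ ≡ e
∣-∣-by p .(p + e) e refl = ∣m-m+n∣≡n p e

∣-∣-by′ : ∀ p q e → q + e ≡ p → ∣ p - q ∣ ≡ e
∣-∣-by′ p q e q+e≡p = trans (∣-∣-comm p q) (∣-∣-by q p e q+e≡p)

+-split : ∀ x g s {w} → g + s ≡ w → x + w ≡ x + g + s
+-split x g s g+s≡w = trans (cong (x +_) (sym g+s≡w)) (sym (+-assoc x g s))

arithmetic-progression : (f : ℕ → ℕ) (d : ℕ) → (∀ k → f (suc k) ≡ f k + d) →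
                         ∀ k → f k ≡ f 0 + k * d
arithmetic-progression f d step zero    = sym (+-identityʳ (f 0))
arithmetic-progression f d step (suc k) = begin
  f (suc k)          ≡⟨ step k ⟩
  f k + d            ≡⟨ cong (_+ d) (arithmetic-progression f d step k) ⟩
  f 0 + k * d + d    ≡⟨ +-assoc (f 0) (k * d) d ⟩
  f 0 + (k * d + d)  ≡⟨ cong (f 0 +_) (+-comm (k * d) d) ⟩
  f 0 + suc k * d    ∎
  where open ≡-Reasoning

-- The graph S_{M+2} □ P_{2K+5}: page b ≤ M is the leaf suc b of the star and the rows
-- are 0, …, 4 + 2K.  The codes enumerate its vertices in the order given by next.
module StackedBookOrdering (K M : ℕ) (3≤M : 3 ≤ M) where
  open CyclicShift M

  data Code : Set where
    start                : Code
    top bottom middle    : ℕ → Code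
    lowPage highPage     : ℕ → ℕ → Code
    lowSpine highSpine   : ℕ → Code

  vertex : Code → ℕ × ℕ
  vertex start          = 0 , 2 + K
  vertex (top i)        = suc i , 4 + K + K
  vertex (bottom i)     = suc (shift^ 1 i) , 0
  vertex (middle i)     = suc (shift^ 3 i) , 2 + K
  vertex (lowPage b j)  = suc b , suc j
  vertex (highPage b j) = suc (shift^ 2 b) , 3 + K + j
  vertex (lowSpine j)   = 0 , suc K ∸ j
  vertex (highSpine j)  = 0 , 4 + K + K ∸ j

  next : Code → Code
  next start = top 0
  next (top i) = bottom i
  next (bottom i) = middle i
  next (middle i) with i ≟ M
  ... | yes _ = lowPage 0 0
  ... | no _  = top (suc i)
  next (lowPage b j) = highPage b j
  next (highPage b j) with j ≟ K
  ... | no _  = lowPage b (suc j)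
  ... | yes _ with b ≟ M
  ...   | no _  = lowPage (suc b) 0
  ...   | yes _ = lowSpine 0
  next (lowSpine j) = highSpine j
  next (highSpine j) = lowSpine (suc j)

  last : Code
  last = highSpine (suc K)

  Valid : Code → Set
  Valid start          = ⊤
  Valid (top i)        = i ≤ M
  Valid (bottom i)     = i ≤ M
  Valid (middle i)     = i ≤ M
  Valid (lowPage b j)  = b ≤ M × j ≤ K
  Valid (highPage b j) = b ≤ M × j ≤ K
  Valid (lowSpine j)   = j ≤ suc K
  Valid (highSpine j)  = j ≤ suc K

  pageLength pagesStart spineStart : ℕ
  pageLength = 2 + K * 2
  pagesStart = 4 + M * 3
  spineStart = suc M * pageLength + pagesStart

  -- The summands are arranged so that index (next c) reduces to suc (index c).
  index : Code → ℕ
  index start          = 0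
  index (top i)        = 1 + i * 3
  index (bottom i)     = 2 + i * 3
  index (middle i)     = 3 + i * 3
  index (lowPage b j)  = j * 2 + b * pageLength + pagesStart
  index (highPage b j) = suc (j * 2 + b * pageLength + pagesStart)
  index (lowSpine j)   = j * 2 + spineStart
  index (highSpine j)  = suc (j * 2 + spineStart)

  index-next : ∀ c → index (next c) ≡ suc (index c)
  index-next start = refl
  index-next (top i) = refl
  index-next (bottom i) = refl
  index-next (middle i) with i ≟ M
  ... | yes refl = refl
  ... | no _     = refl
  index-next (lowPage b j) = refl
  index-next (highPage b j) with j ≟ K
  ... | no _ = refl
  ... | yes refl with b ≟ M
  ...   | no _     = refl
  ...   | yes refl = refl
  index-next (lowSpine j) = refl
  index-next (highSpine j) = refl

  next-valid : ∀ c → Valid c → c ≢ last → Valid (next c)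
  next-valid start _ _ = z≤n
  next-valid (top i) i≤M _ = i≤M
  next-valid (bottom i) i≤M _ = i≤M
  next-valid (middle i) i≤M _ with i ≟ M
  ... | yes _   = z≤n , z≤n
  ... | no i≢M  = ≤∧≢⇒< i≤M i≢M
  next-valid (lowPage b j) b,j≤ _ = b,j≤
  next-valid (highPage b j) (b≤M , j≤K) _ with j ≟ K
  ... | no j≢K = b≤M , ≤∧≢⇒< j≤K j≢K
  ... | yes _ with b ≟ M
  ...   | no b≢M = ≤∧≢⇒< b≤M b≢M , z≤n
  ...   | yes _  = z≤n
  next-valid (lowSpine j) j≤ _ = j≤
  next-valid (highSpine j) j≤ ≢last = ≤∧≢⇒< j≤ (λ { refl → ≢last refl })

  previous : ∀ c → Valid c → c ≢ start → Σ Code λ c′ → Valid c′ × next c′ ≡ c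
  previous start _ ≢start = ⊥-elim (≢start refl)
  previous (top zero) _ _ = start , tt , refl
  previous (top (suc i)) i<M _ = middle i , <⇒≤ i<M , next-middle
    where
    next-middle : next (middle i) ≡ top (suc i)
    next-middle with i ≟ M
    ... | yes refl = ⊥-elim (<-irrefl refl i<M)
    ... | no _     = refl
  previous (bottom i) i≤M _ = top i , i≤M , refl
  previous (middle i) i≤M _ = bottom i , i≤M , refl
  previous (lowPage zero zero) _ _ = middle M , ≤-refl , next-middle
    where
    next-middle : next (middle M) ≡ lowPage 0 0
    next-middle with M ≟ M
    ... | yes _   = refl
    ... | no M≢M  = ⊥-elim (M≢M refl)
  previous (lowPage (suc b) zero) (b<M , _) _ = highPage b K , (<⇒≤ b<M , ≤-refl) , next-high
    where
    next-high : next (highPage b K) ≡ lowPage (suc b) 0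
    next-high with K ≟ K
    ... | no K≢K = ⊥-elim (K≢K refl)
    ... | yes _ with b ≟ M
    ...   | yes refl = ⊥-elim (<-irrefl refl b<M)
    ...   | no _     = refl
  previous (lowPage b (suc j)) (b≤M , j<K) _ = highPage b j , (b≤M , <⇒≤ j<K) , next-high
    where
    next-high : next (highPage b j) ≡ lowPage b (suc j)
    next-high with j ≟ K
    ... | yes refl = ⊥-elim (<-irrefl refl j<K)
    ... | no _     = refl
  previous (highPage b j) b,j≤ _ = lowPage b j , b,j≤ , refl
  previous (lowSpine zero) _ _ = highPage M K , (≤-refl , ≤-refl) , next-high
    where
    next-high : next (highPage M K) ≡ lowSpine 0
    next-high with K ≟ K
    ... | no K≢K = ⊥-elim (K≢K refl)
    ... | yes _ with M ≟ M
    ...   | no M≢M = ⊥-elim (M≢M refl)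
    ...   | yes _  = refl
  previous (lowSpine (suc j)) j<K _ = highSpine j , <⇒≤ j<K , refl
  previous (highSpine j) j≤ _ = lowSpine j , j≤ , refl

  code : ℕ → Code
  code zero    = start
  code (suc t) = next (code t)

  index-code : ∀ t → index (code t) ≡ t
  index-code zero    = refl
  index-code (suc t) = trans (index-next (code t)) (cong suc (index-code t))

  code-index : ∀ c → Valid c → code (index c) ≡ c
  code-index c valid = go (index c) c valid refl
    where
    go : ∀ t c → Valid c → index c ≡ t → code t ≡ c
    go zero start _ _ = refl
    go zero (lowPage b j) _ index≡0 = ⊥-elim (1+n≢0 (m+n≡0⇒n≡0 (j * 2 + b * pageLength) index≡0))
    go zero (lowSpine j) _ index≡0 =
      ⊥-elim (1+n≢0 (m+n≡0⇒n≡0 (suc M * pageLength) (m+n≡0⇒n≡0 (j * 2) index≡0)))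
    go (suc t) c valid index≡ with previous c valid (λ { refl → 0≢1+n index≡ })
    ... | c′ , valid′ , refl =
      cong next (go t c′ valid′ (suc-injective (trans (sym (index-next c′)) index≡)))

  spineStart≤last : spineStart ≤ index last
  spineStart≤last = ≤-trans (m≤n+m spineStart (suc K * 2)) (n≤1+n _)

  pages<spine : ∀ {b j} → b ≤ M → j ≤ K → index (highPage b j) < spineStart
  pages<spine b≤M j≤K = +-monoˡ-≤ pagesStart
    (+-mono-≤ (s≤s (s≤s (*-monoˡ-≤ 2 j≤K))) (*-monoˡ-≤ pageLength b≤M))

  rounds<pages : ∀ {i} → i ≤ M → index (middle i) < pagesStart
  rounds<pages i≤M = s≤s (s≤s (s≤s (s≤s (*-monoˡ-≤ 3 i≤M))))

  index≤last : ∀ c → Valid c → index c ≤ index last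
  index≤last start _ = z≤n
  index≤last (top i) i≤M = ≤-trans (n≤1+n _) (≤-trans (n≤1+n _) (index≤last (middle i) i≤M))
  index≤last (bottom i) i≤M = ≤-trans (n≤1+n _) (index≤last (middle i) i≤M)
  index≤last (middle i) i≤M =
    ≤-trans (<⇒≤ (rounds<pages i≤M))
            (≤-trans (m≤n+m pagesStart (suc M * pageLength)) spineStart≤last)
  index≤last (lowPage b j) (b≤M , j≤K) =
    ≤-trans (n≤1+n _) (≤-trans (<⇒≤ (pages<spine b≤M j≤K)) spineStart≤last)
  index≤last (highPage b j) (b≤M , j≤K) = ≤-trans (<⇒≤ (pages<spine b≤M j≤K)) spineStart≤last
  index≤last (lowSpine j) j≤ = ≤-trans (+-monoˡ-≤ spineStart (*-monoˡ-≤ 2 j≤)) (n≤1+n _)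
  index≤last (highSpine j) j≤ = s≤s (+-monoˡ-≤ spineStart (*-monoˡ-≤ 2 j≤))

  code-≢last : ∀ {t} → t < index last → code t ≢ last
  code-≢last {t} t<T code≡last = <-irrefl (trans (sym (index-code t)) (cong index code≡last)) t<T

  code-valid : ∀ t → t ≤ index last → Valid (code t)
  code-valid zero    _   = tt
  code-valid (suc t) t<T = next-valid (code t) (code-valid t (<⇒≤ t<T)) (code-≢last t<T)

  encode : ∀ a p → a < 2 + M → p < 5 + K + K → Σ Code λ c → Valid c × vertex c ≡ (a , p)
  encode zero p _ p<n with <-cmp p (2 + K)
  ... | tri< p<2+K _ _ =
    lowSpine (suc K ∸ p) , m∸n≤m (suc K) p , cong (0 ,_) (m∸[m∸n]≡n (s≤s⁻¹ p<2+K))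
  ... | tri≈ _ refl _  = start , tt , refl
  ... | tri> _ _ p>2+K =
    highSpine (4 + K + K ∸ p) , offset≤ , cong (0 ,_) (m∸[m∸n]≡n (s≤s⁻¹ p<n))
    where
    offset≤ : 4 + K + K ∸ p ≤ suc K
    offset≤ = ≤-trans (∸-monoʳ-≤ (4 + K + K) p>2+K)
                      (≤-reflexive (m+n∸n≡m (suc K) K))
  encode (suc s) p a<m p<n with s≤s⁻¹ (s≤s⁻¹ a<m) | <-cmp p (2 + K)
  ... | s≤M | tri< p<2+K _ _ with p
  ...   | zero   =
    bottom (unshift^ 1 s) , unshift^-≤ 1 s≤M , cong (λ b → suc b , 0) (shift^-unshift^ 1 s≤M)
  ...   | suc p′ = lowPage s p′ , (s≤M , s≤s⁻¹ (s≤s⁻¹ p<2+K)) , refl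
  encode (suc s) p a<m p<n | s≤M | tri≈ _ refl _ =
    middle (unshift^ 3 s) , unshift^-≤ 3 s≤M , cong (λ b → suc b , 2 + K) (shift^-unshift^ 3 s≤M)
  encode (suc s) p a<m p<n | s≤M | tri> _ _ p>2+K with p ≟ 4 + K + K
  ... | yes refl = top s , s≤M , refl
  ... | no p≢4+2K = highPage (unshift^ 2 s) (p ∸ (3 + K)) , (unshift^-≤ 2 s≤M , offset≤) ,
                    cong₂ _,_ (cong suc (shift^-unshift^ 2 s≤M)) (m+[n∸m]≡n p>2+K)
    where
    offset≤ : p ∸ (3 + K) ≤ K
    offset≤ = ≤-trans (∸-monoˡ-≤ (3 + K) (s≤s⁻¹ (≤∧≢⇒< (s≤s⁻¹ p<n) p≢4+2K)))
                      (≤-reflexive (m+n∸n≡m K K))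

  stepDist : Code → ℕ
  stepDist start = 3 + K
  stepDist (top _) = 6 + K + K
  stepDist (bottom _) = 4 + K
  stepDist (middle i) with i ≟ M
  ... | yes _ = 3 + K
  ... | no _  = 4 + K
  stepDist (lowPage _ _) = 4 + K
  stepDist (highPage b j) with j ≟ K
  ... | no _  = 3 + K
  ... | yes _ with b ≟ M
  ...   | no _  = 4 + K + K
  ...   | yes _ = 3 + K
  stepDist (lowSpine _) = 3 + K
  stepDist (highSpine _) = 4 + K

  pages-differ : ∀ j k {s} → j < k → k ≤ 3 → s ≤ M → shift^ j s ≢ shift^ k s
  pages-differ j k j<k k≤3 = shift^-distinct j k j<k (≤-trans k≤3 3≤M)

  a∸j+b≡c∸j : ∀ a b c {j} → j ≤ a → a + b ≡ c → (a ∸ j) + b ≡ c ∸ j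
  a∸j+b≡c∸j a b c {j} j≤a a+b≡c = trans (sym (+-∸-comm b j≤a)) (cong (_∸ j) a+b≡c)

  dist-next : ∀ c → Valid c → c ≢ last → bookDist (vertex c) (vertex (next c)) ≡ stepDist c
  dist-next start _ _ = cong suc (∣-∣-by (2 + K) (4 + K + K) (2 + K) (solve (K ∷ [])))
  dist-next (top i) i≤M _ =
    cong₂ _+_ (starDist-leaves (pages-differ 0 1 z<s (s≤s z≤n) i≤M)) refl
  dist-next (bottom i) i≤M _ =
    cong₂ _+_ (starDist-leaves (pages-differ 1 3 (s<s z<s) ≤-refl i≤M)) refl
  dist-next (middle i) i≤M _ with i ≟ M
  ... | yes refl = cong₂ _+_ (starDist-leaves λ shift³M≡0 →
                     pages-differ 1 3 (s<s z<s) ≤-refl ≤-refl (trans shift-max (sym shift³M≡0))) refl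
  ... | no i≢M = cong₂ _+_
    (starDist-leaves λ shift³i≡1+i →
      pages-differ 1 3 (s<s z<s) ≤-refl i≤M (trans (shift-< (≤∧≢⇒< i≤M i≢M)) (sym shift³i≡1+i)))
    (∣-∣-by (2 + K) (4 + K + K) (2 + K) (solve (K ∷ [])))
  dist-next (lowPage b j) (b≤M , _) _ = cong₂ _+_
    (starDist-leaves (pages-differ 0 2 z<s (s≤s (s≤s z≤n)) b≤M))
    (∣-∣-by (suc j) (3 + K + j) (2 + K) (solve (K ∷ j ∷ [])))
  dist-next (highPage b j) (b≤M , j≤K) _ with j ≟ K
  ... | no _ = cong₂ _+_
    (starDist-leaves λ shift²b≡b → pages-differ 0 2 z<s (s≤s (s≤s z≤n)) b≤M (sym shift²b≡b))
    (∣-∣-by′ (3 + K + j) (2 + j) (1 + K) (solve (K ∷ j ∷ [])))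
  ... | yes refl with b ≟ M
  ...   | no b≢M = cong₂ _+_
    (starDist-leaves λ shift²b≡1+b →
      pages-differ 1 2 (s<s z<s) (s≤s (s≤s z≤n)) b≤M
        (trans (shift-< (≤∧≢⇒< b≤M b≢M)) (sym shift²b≡1+b)))
    refl
  ...   | yes refl = cong suc (∣-∣-by′ (3 + K + K) (suc K) (2 + K) (solve (K ∷ [])))
  dist-next (lowSpine j) j≤1+K _ =
    ∣-∣-by (suc K ∸ j) (4 + K + K ∸ j) (3 + K)
      (a∸j+b≡c∸j (suc K) (3 + K) (4 + K + K) j≤1+K (solve (K ∷ [])))
  dist-next (highSpine j) j≤1+K ≢last =
    ∣-∣-by′ (4 + K + K ∸ j) (K ∸ j) (4 + K)
      (a∸j+b≡c∸j K (4 + K) (4 + K + K) j≤K (solve (K ∷ [])))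
    where
    j≤K : j ≤ K
    j≤K = s≤s⁻¹ (≤∧≢⇒< j≤1+K λ { refl → ≢last refl })

  stepDist-middle≤ : ∀ i → stepDist (middle i) ≤ 4 + K
  stepDist-middle≤ i with i ≟ M
  ... | yes _ = n≤1+n _
  ... | no _  = ≤-refl

  stepDist-highPage≤ : ∀ b j → stepDist (highPage b j) ≤ 4 + K + K
  stepDist-highPage≤ b j with j ≟ K
  ... | no _ = ≤-trans (n≤1+n _) (m≤m+n (4 + K) K)
  ... | yes _ with b ≟ M
  ...   | no _  = ≤-refl
  ...   | yes _ = ≤-trans (n≤1+n _) (m≤m+n (4 + K) K)

  stepDist-highPage₀≤ : ∀ b → stepDist (highPage b 0) ≤ 4 + K
  stepDist-highPage₀≤ b with 0 ≟ K
  ... | no _ = n≤1+n _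
  ... | yes 0≡K with b ≟ M
  ...   | no _  = subst (λ k → 4 + K + k ≤ 4 + K) 0≡K (≤-reflexive (+-identityʳ (4 + K)))
  ...   | yes _ = n≤1+n _

  stepDist-after-highPage≤ : ∀ b j → stepDist (next (highPage b j)) ≤ 4 + K
  stepDist-after-highPage≤ b j with j ≟ K
  ... | no _ = ≤-refl
  ... | yes _ with b ≟ M
  ...   | no _  = ≤-refl
  ...   | yes _ = n≤1+n _

  4+K≤7+K+K : 4 + K ≤ 7 + K + K
  4+K≤7+K+K = m+k≡n⇒m≤n (4 + K) (7 + K + K) (3 + K) (solve (K ∷ []))

  stepDist≤ : ∀ c → stepDist c ≤ 7 + K + K
  stepDist≤ start = m+k≡n⇒m≤n (3 + K) (7 + K + K) (4 + K) (solve (K ∷ []))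
  stepDist≤ (top _) = n≤1+n _
  stepDist≤ (bottom _) = 4+K≤7+K+K
  stepDist≤ (middle i) = ≤-trans (stepDist-middle≤ i) 4+K≤7+K+K
  stepDist≤ (lowPage _ _) = 4+K≤7+K+K
  stepDist≤ (highPage b j) =
    ≤-trans (stepDist-highPage≤ b j) (m+k≡n⇒m≤n (4 + K + K) (7 + K + K) 3 (solve (K ∷ [])))
  stepDist≤ (lowSpine _) = m+k≡n⇒m≤n (3 + K) (7 + K + K) (4 + K) (solve (K ∷ []))
  stepDist≤ (highSpine _) = 4+K≤7+K+K

  two-steps-via : ∀ x d k {D} → d ≤ D → x + k ≡ 7 + K + K + d → x ≤ 7 + K + K + D
  two-steps-via x d k d≤ eq = ≤-trans (m+k≡n⇒m≤n x _ k eq) (+-monoʳ-≤ (7 + K + K) d≤)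

  two-steps : ∀ c → Valid c → c ≢ last → next c ≢ last →
              stepDist c + stepDist (next c) ≤
              7 + K + K + bookDist (vertex c) (vertex (next (next c)))
  two-steps start _ _ _ = two-steps-via ((3 + K) + (6 + K + K)) (3 + K) 1 ≤-refl (solve (K ∷ []))
  two-steps (top i) i≤M _ _ = two-steps-via ((6 + K + K) + (4 + K)) (4 + K) 1
    (≤-reflexive (sym (cong₂ _+_ (starDist-leaves (pages-differ 0 3 z<s ≤-refl i≤M))
                                 (∣-∣-by′ (4 + K + K) (2 + K) (2 + K) (solve (K ∷ []))))))
    (solve (K ∷ []))
  two-steps (bottom i) i≤M _ _ with i ≟ M
  ... | yes _ = two-steps-via ((4 + K) + (3 + K)) 0 0 z≤n (solve (K ∷ []))
  ... | no _  = two-steps-via ((4 + K) + (4 + K)) (4 + K + K) (3 + K + K) (m≤n+m _ _) (solve (K ∷ []))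
  two-steps (middle i) i≤M _ _ with i ≟ M
  ... | yes _  = two-steps-via ((3 + K) + (4 + K)) 0 0 z≤n (solve (K ∷ []))
  ... | no i≢M = two-steps-via ((4 + K) + (6 + K + K)) (4 + K) 1
    (≤-reflexive (sym (cong (_+ (2 + K)) (starDist-leaves λ shift³i≡shift[1+i] →
      pages-differ 2 3 (s<s (s<s z<s)) ≤-refl i≤M
        (trans (cong shift (shift-< (≤∧≢⇒< i≤M i≢M))) (sym shift³i≡shift[1+i]))))))
    (solve (K ∷ []))
  two-steps (lowPage b j) (b≤M , _) _ _ with j ≟ K
  ... | no _ = two-steps-via ((4 + K) + (3 + K)) 0 0 z≤n (solve (K ∷ []))
  ... | yes refl with b ≟ M
  ...   | no _  = two-steps-via ((4 + K) + (4 + K + K)) (2 + K) 1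
    (≤-reflexive (sym (cong₂ _+_ (starDist-leaves λ b≡1+b → 1+n≢n (sym b≡1+b)) (∣-∣-identityʳ K))))
    (solve (K ∷ []))
  ...   | yes _ = two-steps-via ((4 + K) + (3 + K)) 0 0 z≤n (solve (K ∷ []))
  two-steps (highPage b j) (b≤M , _) _ _ with j ≟ K
  ... | no _ = two-steps-via ((3 + K) + (4 + K)) 0 0 z≤n (solve (K ∷ []))
  ... | yes refl with b ≟ M
  ...   | no b≢M = two-steps-via ((4 + K + K) + (4 + K)) (2 + K) 1
    (≤-reflexive (sym (cong₂ _+_
      (starDist-leaves λ shift²b≡shift²[1+b] →
        pages-differ 2 3 (s<s (s<s z<s)) ≤-refl b≤M
          (trans shift²b≡shift²[1+b] (cong (shift^ 2) (sym (shift-< (≤∧≢⇒< b≤M b≢M))))))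
      (∣-∣-by′ (3 + K + K) (3 + K + 0) K (solve (K ∷ []))))))
    (solve (K ∷ []))
  ...   | yes _ = two-steps-via ((3 + K) + (3 + K)) 0 1 z≤n (solve (K ∷ []))
  two-steps (lowSpine j) _ _ _ = two-steps-via ((3 + K) + (4 + K)) 0 0 z≤n (solve (K ∷ []))
  two-steps (highSpine j) _ _ _ = two-steps-via ((4 + K) + (3 + K)) 0 0 z≤n (solve (K ∷ []))

  three-steps-via : ∀ a b c k {s} → s ≤ c → a + b + c + k ≡ 2 * (7 + K + K) →
                    a + b + s ≤ 2 * (7 + K + K)
  three-steps-via a b c k s≤c eq = ≤-trans (+-monoʳ-≤ (a + b) s≤c) (m+k≡n⇒m≤n _ _ k eq)

  three-steps : ∀ c → stepDist c + stepDist (next c) + stepDist (next (next c)) ≤ 2 * (7 + K + K)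
  three-steps start = three-steps-via (3 + K) (6 + K + K) (4 + K) 1 ≤-refl (solve (K ∷ []))
  three-steps (top i) = three-steps-via (6 + K + K) (4 + K) (4 + K) 0 (stepDist-middle≤ i) (solve (K ∷ []))
  three-steps (bottom i) with i ≟ M
  ... | yes _ = three-steps-via (4 + K) (3 + K) (4 + K) (3 + K) ≤-refl (solve (K ∷ []))
  ... | no _  = three-steps-via (4 + K) (4 + K) (6 + K + K) 0 ≤-refl (solve (K ∷ []))
  three-steps (middle i) with i ≟ M
  ... | yes _ = three-steps-via (3 + K) (4 + K) (4 + K + K) 3 (stepDist-highPage≤ 0 0) (solve (K ∷ []))
  ... | no _  = three-steps-via (4 + K) (6 + K + K) (4 + K) 0 ≤-refl (solve (K ∷ []))
  three-steps (lowPage b j) = ≤-trans (+-monoˡ-≤ _ (+-monoʳ-≤ (4 + K) (stepDist-highPage≤ b j)))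
    (three-steps-via (4 + K) (4 + K + K) (4 + K) 2 (stepDist-after-highPage≤ b j) (solve (K ∷ [])))
  three-steps (highPage b j) with j ≟ K
  ... | no _ = three-steps-via (3 + K) (4 + K) (4 + K + K) 3 (stepDist-highPage≤ b (suc j)) (solve (K ∷ []))
  ... | yes _ with b ≟ M
  ...   | no _  = three-steps-via (4 + K + K) (4 + K) (4 + K) 2 (stepDist-highPage₀≤ (suc b)) (solve (K ∷ []))
  ...   | yes _ = three-steps-via (3 + K) (3 + K) (4 + K) (4 + K) ≤-refl (solve (K ∷ []))
  three-steps (lowSpine j) = three-steps-via (3 + K) (4 + K) (3 + K) (4 + K) ≤-refl (solve (K ∷ []))
  three-steps (highSpine j) = three-steps-via (4 + K) (3 + K) (4 + K) (3 + K) ≤-refl (solve (K ∷ []))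

  -- Each label exceeds the previous one by 7 + 2K = diam + 1 minus their distance (label-next).
  -- labelLow splits on j first, so that labelLow b (suc j) computes for a variable b.
  labelTop labelBottom labelMiddle : ℕ → ℕ
  labelLow labelHigh : ℕ → ℕ → ℕ
  labelLowSpine labelHighSpine : ℕ → ℕ

  labelTop zero    = 4 + K
  labelTop (suc i) = labelMiddle i + (3 + K)
  labelBottom i = labelTop i + 1
  labelMiddle i = labelBottom i + (3 + K)
  labelLow b       (suc j) = labelHigh b j + (4 + K)
  labelLow zero    zero    = labelMiddle M + (4 + K)
  labelLow (suc b) zero    = labelHigh b K + 3
  labelHigh b j = labelLow b j + (3 + K)
  labelLowSpine zero    = labelHigh M K + (4 + K)
  labelLowSpine (suc j) = labelHighSpine j + (3 + K)
  labelHighSpine j = labelLowSpine j + (4 + K)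

  label : Code → ℕ
  label start          = 0
  label (top i)        = labelTop i
  label (bottom i)     = labelBottom i
  label (middle i)     = labelMiddle i
  label (lowPage b j)  = labelLow b j
  label (highPage b j) = labelHigh b j
  label (lowSpine j)   = labelLowSpine j
  label (highSpine j)  = labelHighSpine j

  label-next : ∀ c → label c + (7 + K + K) ≡ label (next c) + stepDist c
  label-next start = +-split 0 (4 + K) (3 + K) (solve (K ∷ []))
  label-next (top i) = +-split (labelTop i) 1 (6 + K + K) refl
  label-next (bottom i) = +-split (labelBottom i) (3 + K) (4 + K) (solve (K ∷ []))
  label-next (middle i) with i ≟ M
  ... | yes refl = +-split (labelMiddle M) (4 + K) (3 + K) (solve (K ∷ []))
  ... | no _     = +-split (labelMiddle i) (3 + K) (4 + K) (solve (K ∷ []))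
  label-next (lowPage b j) = +-split (labelLow b j) (3 + K) (4 + K) (solve (K ∷ []))
  label-next (highPage b j) with j ≟ K
  ... | no _ = +-split (labelHigh b j) (4 + K) (3 + K) (solve (K ∷ []))
  ... | yes refl with b ≟ M
  ...   | no _     = +-split (labelHigh b K) 3 (4 + K + K) refl
  ...   | yes refl = +-split (labelHigh M K) (4 + K) (3 + K) (solve (K ∷ []))
  label-next (lowSpine j) = +-split (labelLowSpine j) (4 + K) (3 + K) (solve (K ∷ []))
  label-next (highSpine j) = +-split (labelHighSpine j) (3 + K) (4 + K) (solve (K ∷ []))

  labelTop-closed : ∀ i → labelTop i ≡ 4 + K + i * (7 + K + K)
  labelTop-closed = arithmetic-progression labelTop (7 + K + K) λ i →
    trans (+-assoc (labelTop i + 1) (3 + K) (3 + K))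
          (trans (+-assoc (labelTop i) 1 _) (cong (labelTop i +_) (solve (K ∷ []))))

  labelLow-row : ∀ b j → labelLow b j ≡ labelLow b 0 + j * (7 + K + K)
  labelLow-row b = arithmetic-progression (labelLow b) (7 + K + K) λ j →
    sym (+-split (labelLow b j) (3 + K) (4 + K) (solve (K ∷ [])))

  labelLow-column : ∀ b → labelLow b 0 ≡ labelLow 0 0 + b * (K * (7 + K + K) + (6 + K))
  labelLow-column = arithmetic-progression (λ b → labelLow b 0) _ λ b → begin
    labelLow b K + (3 + K) + 3
      ≡⟨ cong (λ x → x + (3 + K) + 3) (labelLow-row b K) ⟩
    labelLow b 0 + K * (7 + K + K) + (3 + K) + 3
      ≡⟨ page-end (labelLow b 0) ⟩
    labelLow b 0 + (K * (7 + K + K) + (6 + K)) ∎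
    where
    open ≡-Reasoning
    page-end : ∀ x → x + K * (7 + K + K) + (3 + K) + 3 ≡ x + (K * (7 + K + K) + (6 + K))
    page-end x = solve (x ∷ K ∷ [])

  labelLowSpine-row : ∀ j → labelLowSpine j ≡ labelLowSpine 0 + j * (7 + K + K)
  labelLowSpine-row = arithmetic-progression labelLowSpine (7 + K + K) λ j →
    sym (+-split (labelLowSpine j) (4 + K) (3 + K) (solve (K ∷ [])))

  label-last : label last ≡
    4 + K + M * (7 + K + K) + 1 + (3 + K) + (4 + K) + M * (K * (7 + K + K) + (6 + K))
      + K * (7 + K + K) + (3 + K) + (4 + K) + suc K * (7 + K + K) + (4 + K)
  label-last = begin
    labelLowSpine (suc K) + (4 + K)
      ≡⟨ cong (_+ (4 + K)) (labelLowSpine-row (suc K)) ⟩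
    labelLow M K + (3 + K) + (4 + K) + suc K * (7 + K + K) + (4 + K)
      ≡⟨ cong (λ x → x + (3 + K) + (4 + K) + suc K * (7 + K + K) + (4 + K)) (labelLow-row M K) ⟩
    labelLow M 0 + K * (7 + K + K) + (3 + K) + (4 + K) + suc K * (7 + K + K) + (4 + K)
      ≡⟨ cong (λ x → x + K * (7 + K + K) + (3 + K) + (4 + K) + suc K * (7 + K + K) + (4 + K))
              (labelLow-column M) ⟩
    labelTop M + 1 + (3 + K) + (4 + K) + M * (K * (7 + K + K) + (6 + K))
      + K * (7 + K + K) + (3 + K) + (4 + K) + suc K * (7 + K + K) + (4 + K)
      ≡⟨ cong (λ x → x + 1 + (3 + K) + (4 + K) + M * (K * (7 + K + K) + (6 + K))
                       + K * (7 + K + K) + (3 + K) + (4 + K) + suc K * (7 + K + K) + (4 + K))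
              (labelTop-closed M) ⟩
    4 + K + M * (7 + K + K) + 1 + (3 + K) + (4 + K) + M * (K * (7 + K + K) + (6 + K))
      + K * (7 + K + K) + (3 + K) + (4 + K) + suc K * (7 + K + K) + (4 + K) ∎
    where open ≡-Reasoning

  span-identity : 2 * label last + 2 ≡ (2 + M) * (5 + K + K) * (5 + K + K) + 2 * (5 + K + K) + (2 + M)
  span-identity = trans (cong (λ x → 2 * x + 2) label-last) (solve (K ∷ M ∷ []))

  vertexAt : ℕ → ℕ × ℕ
  vertexAt t = vertex (code t)

  distAt : ℕ → ℕ → ℕ
  distAt s t = bookDist (vertexAt s) (vertexAt t)

  dist-consecutive : ∀ {t} → suc t ≤ index last → distAt t (suc t) ≡ stepDist (code t)
  dist-consecutive {t} t<T = dist-next (code t) (code-valid t (<⇒≤ t<T)) (code-≢last t<T)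

  code-two-steps : ∀ t → 2 + t ≤ index last →
                   distAt t (1 + t) + distAt (1 + t) (2 + t) ≤ 7 + K + K + distAt t (2 + t)
  code-two-steps t 2+t≤T = begin
    distAt t (1 + t) + distAt (1 + t) (2 + t)
      ≡⟨ cong₂ _+_ (dist-consecutive (<⇒≤ 2+t≤T)) (dist-consecutive 2+t≤T) ⟩
    stepDist (code t) + stepDist (code (1 + t))
      ≤⟨ two-steps (code t) (code-valid t (≤-trans (n≤1+n t) (<⇒≤ 2+t≤T)))
                   (code-≢last (<⇒≤ 2+t≤T)) (code-≢last 2+t≤T) ⟩
    7 + K + K + distAt t (2 + t) ∎
    where open ≤-Reasoning

  code-three-steps : ∀ t → 3 + t ≤ index last →
                     distAt t (1 + t) + distAt (1 + t) (2 + t) + distAt (2 + t) (3 + t) ≤ 2 * (7 + K + K)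
  code-three-steps t 3+t≤T = begin
    distAt t (1 + t) + distAt (1 + t) (2 + t) + distAt (2 + t) (3 + t)
      ≡⟨ cong₂ _+_ (cong₂ _+_ (dist-consecutive (<⇒≤ (<⇒≤ 3+t≤T))) (dist-consecutive (<⇒≤ 3+t≤T)))
                   (dist-consecutive 3+t≤T) ⟩
    stepDist (code t) + stepDist (code (1 + t)) + stepDist (code (2 + t))
      ≤⟨ three-steps (code t) ⟩
    2 * (7 + K + K) ∎
    where open ≤-Reasoning

  open DistanceGapOrdering bookDist (7 + K + K) (index last) vertexAt (λ t → label (code t))
    (λ t t<T → trans (label-next (code t))
                     (cong (label (code (suc t)) +_) (sym (dist-consecutive t<T))))
    (λ t t<T → ≤-trans (≤-reflexive (dist-consecutive t<T)) (stepDist≤ (code t)))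
    code-two-steps code-three-steps

  position : V (2 + M) (5 + K + K) → ℕ
  position (a , i) = index (proj₁ (encode (toℕ a) (toℕ i) (toℕ<n a) (toℕ<n i)))

  vertex-position : ∀ u → vertex (code (position u)) ≡ coords u
  vertex-position (a , i) with encode (toℕ a) (toℕ i) (toℕ<n a) (toℕ<n i)
  ... | c , valid , vertex≡ = trans (cong vertex (code-index c valid)) vertex≡

  position≤last : ∀ u → position u ≤ index last
  position≤last (a , i) with encode (toℕ a) (toℕ i) (toℕ<n a) (toℕ<n i)
  ... | c , valid , _ = index≤last c valid

  radioLabel : V (2 + M) (5 + K + K) → ℕ
  radioLabel u = label (code (position u))

  radioLabel-gap : ∀ u v → u ≢ v →
                   7 + K + K ≤ ∣ radioLabel u - radioLabel v ∣ + bookDist (coords u) (coords v)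
  radioLabel-gap u v u≢v =
    subst₂ (λ p q → 7 + K + K ≤ ∣ radioLabel u - radioLabel v ∣ + bookDist p q)
           (vertex-position u) (vertex-position v)
           (radio-condition bookDist-sym position≢ (position≤last u) (position≤last v))
    where
    position≢ : position u ≢ position v
    position≢ eq = u≢v (coords-injective
      (trans (sym (vertex-position u)) (trans (cong vertexAt eq) (vertex-position v))))

  radioLabel-isRadioLabeling : IsRadioLabeling (2 + M) (5 + K + K) (6 + K + K) radioLabel
  radioLabel-isRadioLabeling = isRadioLabeling (6 + K + K) radioLabel λ u v u≢v →
    subst (_≤ ∣ radioLabel u - radioLabel v ∣ + bookDist (coords u) (coords v))
          (+-comm 1 (6 + K + K)) (radioLabel-gap u v u≢v)

  radioLabel-span : 2 * span (2 + M) (5 + K + K) radioLabel ≤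
                    (2 + M) * (5 + K + K) * (5 + K + K) + 2 * (5 + K + K) + (2 + M) ∸ 2
  radioLabel-span = begin
    2 * span (2 + M) (5 + K + K) radioLabel  ≤⟨ *-monoʳ-≤ 2 (span≤ radioLabel (label last) radioLabel≤) ⟩
    2 * label last                           ≡⟨ sym (m+n∸n≡m (2 * label last) 2) ⟩
    2 * label last + 2 ∸ 2                   ≡⟨ cong (_∸ 2) span-identity ⟩
    (2 + M) * (5 + K + K) * (5 + K + K) + 2 * (5 + K + K) + (2 + M) ∸ 2 ∎
    where
    open ≤-Reasoning
    radioLabel≤ : ∀ u → radioLabel u ≤ label last
    radioLabel≤ u = subst (radioLabel u ≤_) (cong label (code-index last ≤-refl))
                          (F-mono (position≤last u) ≤-refl)

odd≥5 : ∀ n → 5 ≤ n → n % 2 ≡ 1 → ∃ λ K → 5 + K + K ≡ n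
odd≥5 n 5≤n n%2≡1 = halve (n / 2) (trans (m≡m%n+[m/n]*n n 2) (cong (_+ n / 2 * 2) n%2≡1))
  where
  halve : ∀ h → n ≡ 1 + h * 2 → ∃ λ K → 5 + K + K ≡ n
  halve 0             n≡1 = contradiction (subst (5 ≤_) n≡1 5≤n) λ { (s≤s ()) }
  halve 1             n≡3 = contradiction (subst (5 ≤_) n≡3 5≤n) λ { (s≤s (s≤s (s≤s ()))) }
  halve (suc (suc K)) n≡  = K , trans (odd-form K) (sym n≡)
    where
    odd-form : ∀ K → 5 + K + K ≡ 1 + (2 + K) * 2
    odd-form K = solve (K ∷ [])

mainTheorem1 : (m n : ℕ) → 5 ≤ m → 5 ≤ n → n % 2 ≡ 1 →
    ∃ λ D → IsDiameter m n D ×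
      ∃ λ (f : V m n → ℕ) → IsRadioLabeling m n D f ×
        2 * span m n f ≤ m * n * n + 2 * n + m ∸ 2
mainTheorem1 m n 5≤m 5≤n n-odd with m ∸ 5 | m+[n∸m]≡n 5≤m | odd≥5 n 5≤n n-odd
... | M | refl | K , refl =
  6 + K + K , isDiameter (2 + M) (4 + K + K) , radioLabel , radioLabel-isRadioLabeling , radioLabel-span
  where open StackedBookOrdering K (3 + M) (m≤m+n 3 M)
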